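{- For all integers $k, m \ge 0$, we have \[ \tau_m|_{I_k} = \begin{cases} \sum_{i = 0}^m p^i \left( A_{k, 2i - (m - k)}^{(+1)} \right)_{*} & \text{if } m \le k;\\ \sum_{i = 0}^{m - k - 1} p^i \left( A_{k, i}^{((-1)^{m - k - i})} \right)_{*} + \sum_{i = m - k}^{m} p^i \left( A_{k, 2i - (m - k)}^{(+1)} \right)_{*} & \text{if } m \ge k + 1. \end{cases} \]
   Context: $p$ is a fixed prime. Correspondences on the interval $\left[0, \frac{p}{p+1}\right]$ act linearly on divisors (finite formal $\mathbb{Z}$-combinations of points, $[x]$ the divisor of a point, $f_*$ push-forward by a map $f$). Let $\tau_0$ be the identity, let $\tau_1$ be defined by $\tau_1(x) = [px] + p[\frac{x}{p}]$ if $x \in \left[0, \frac{1}{p + 1} \right]$ and $\tau_1(x) = [1 - x] + p[\frac{x}{p}]$ if $x \in \left] \frac{1}{p + 1}, \frac{p}{p + 1} \right]$, and for $m\ge2$ let $\tau_m \= \tau_1 \circ \tau_{m - 1} - p \tau_{m - 2}$. For each integer $k \ge 0$ put $x_k \= \frac{p}{p + 1} \cdot p^{ -k}$ and $I_k \= [x_{k + 1}, x_k]$, so that $\bigcup_{k\ge0} I_k = \left]0, \frac{p}{p+1}\right]$. For integers $k, k' \ge 0$, $A_{k, k'}^{(+1)} \colon I_k \to I_{k'}$ (resp. $A_{k, k'}^{(-1)} \colon I_k \to I_{k'}$) denotes the unique affine bijection preserving (resp. reversing) orientation; $\tau_m|_{I_k}$ denotes the restriction of $\tau_m$ to divisors supported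 on $I_k$.
   Formalization: Divisors are supported only on rational points of the interval $\left[0, \frac{p}{p+1}\right]$. -}

module Defs where

open import Data.Nat as ℕ using (ℕ; zero; suc)
open import Data.Integer as ℤ using (ℤ; +_)
open import Data.Rational as ℚ using (ℚ; 0ℚ; 1ℚ; _≤_; _≤ᵇ_; ≢-nonZero)
open import Data.Rational.Properties using (_≟_)
open import Data.Product using (_×_; _,_)
open import Data.List using (List; []; _∷_; _++_; map; concatMap; foldr)
open import Data.Bool using (Bool; true; false; if_then_else_)
open import Relation.Nullary using (yes; no; does)
open import Relation.Binary.PropositionalEquality using (_≡_)

-- Divisors: finite formal ℤ-combinations of (rational) points,
-- represented as lists of (coefficient , point).
Divisor : Set
Divisor = List (ℤ × ℚ)

pt : ℚ → Divisor
pt x = (+ 1 , x) ∷ []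

coeff : Divisor → ℚ → ℤ
coeff [] y = + 0
coeff ((c , x) ∷ D) y = if does (x ≟ y) then c ℤ.+ coeff D y else coeff D y

_≈D_ : Divisor → Divisor → Set
D ≈D E = ∀ y → coeff D y ≡ coeff E y

scale : ℤ → Divisor → Divisor
scale a = map (λ { (c , x) → (a ℤ.* c , x) })

push : (ℚ → ℚ) → Divisor → Divisor
push f = map (λ { (c , x) → (c , f x) })

linExt : (ℚ → Divisor) → Divisor → Divisor
linExt T = concatMap (λ { (c , x) → scale c (T x) })

-- 1/n for a natural number n ≥ 1 (and 0 for n = 0, never used)
invℕ : ℕ → ℚ
invℕ zero = 0ℚ
invℕ (suc n) = + 1 ℚ./ suc n

-- 1/q for a rational q ≠ 0 (and 0 for q = 0, never used)
recip : ℚ → ℚ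
recip q with q ≟ 0ℚ
... | yes _ = 0ℚ
... | no q≢0 = ℚ.1/_ q {{≢-nonZero q≢0}}

module _ (p : ℕ) where

  pℚ : ℚ
  pℚ = + p ℚ./ 1

  -- the correspondence τ₁ on a point x ∈ [0, p/(p+1)]
  τ₁pt : ℚ → Divisor
  τ₁pt x =
    if x ≤ᵇ invℕ (suc p)
    then (+ 1 , pℚ ℚ.* x) ∷ (+ p , x ℚ.* invℕ p) ∷ []
    else (+ 1 , 1ℚ ℚ.- x) ∷ (+ p , x ℚ.* invℕ p) ∷ []

  τ₁ : Divisor → Divisor
  τ₁ = linExt τ₁pt

  τ : ℕ → Divisor → Divisor
  τ zero D = D
  τ (suc zero) D = τ₁ D
  τ (suc (suc m)) D = τ₁ (τ (suc m) D) ++ scale (ℤ.- (+ p)) (τ m D)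

  xk : ℕ → ℚ
  xk k = (pℚ ℚ.* invℕ (suc p)) ℚ.* invℕ (p ℕ.^ k)

  InI : ℕ → ℚ → Set
  InI k x = (xk (suc k) ≤ x) × (x ≤ xk k)

  -- A^{(+1)}_{k,k'} : I_k → I_{k'}, orientation preserving affine bijection
  Aplus : ℕ → ℕ → ℚ → ℚ
  Aplus k k' x =
    xk (suc k') ℚ.+ ((x ℚ.- xk (suc k)) ℚ.* (xk k' ℚ.- xk (suc k'))) ℚ.* recip (xk k ℚ.- xk (suc k))

  -- A^{(-1)}_{k,k'} : I_k → I_{k'}, orientation reversing affine bijection
  Aminus : ℕ → ℕ → ℚ → ℚ
  Aminus k k' x =
    xk k' ℚ.- ((x ℚ.- xk (suc k)) ℚ.* (xk k' ℚ.- xk (suc k'))) ℚ.* recip (xk k ℚ.- xk (suc k))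

  -- A^{(ε)} with ε = (-1)^n
  Asign : ℕ → ℕ → ℕ → ℚ → ℚ
  Asign n k k' with n ℕ.% 2
  ... | zero = Aplus k k'
  ... | suc _ = Aminus k k'

  -- Σ_{i=a}^{b} F i  for divisors  (empty when b < a)
  ΣD : ℕ → ℕ → (ℕ → Divisor) → Divisor
  ΣD a b F = go (suc b ℕ.∸ a) a
    where
    go : ℕ → ℕ → Divisor
    go zero i = []
    go (suc n) i = F i ++ go n (suc i)

  rhs : ℕ → ℕ → Divisor → Divisor
  rhs k m D with m ℕ.≤ᵇ k
  ... | true =
    ΣD 0 m (λ i → scale (+ (p ℕ.^ i)) (push (Aplus k ((2 ℕ.* i ℕ.+ k) ℕ.∸ m)) D))
  ... | false =
    ΣD 0 (m ℕ.∸ k ℕ.∸ 1)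
       (λ i → scale (+ (p ℕ.^ i)) (push (Asign (m ℕ.∸ k ℕ.∸ i) k i) D))
    ++ ΣD (m ℕ.∸ k) m
       (λ i → scale (+ (p ℕ.^ i)) (push (Aplus k ((2 ℕ.* i ℕ.+ k) ℕ.∸ m)) D))

-- Divisors are compared through their pairings ⟨w, D⟩ = Σ c · w(x) with
-- integer weights w : ℚ → ℤ.  A coefficient is the pairing with an indicator
-- weight, so divisors with the same pairings against every weight are equal,
-- and the theorem becomes an identity of integers for each weight.
--
-- Write (n , j) for the affine bijection A^{((-1)^n)}_{k,j} : I_k → I_j.
--   * Geometry: for x ∈ I_k, τ₁(A_l x) = [A_{expand l} x] + p [A_{contract l} x],
--     where expand is the branch x ↦ px (x ↦ 1 - x on I₀) and contract is
--     x ↦ x/p; this only uses that I_j = [x_{j+1}, x_j] with x_j = p x_{j+1}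
--     and x₀ + x₁ = 1.
--   * Combinatorics: the label sums S_m(W) = Σ_{i=0}^{m} p^i W(label m i),
--     which encode the right-hand side, satisfy S_{m+1}(τ₁ᵀ W) = S_{m+2}(W) +
--     p S_m(W), the recursion defining τ_m.
--   * Main: by induction on m, ⟨w, τ_m D⟩ = S_m(W_w) with W_w(l) = ⟨w, (A_l)_* D⟩,
--     and the right-hand side has the same pairings.
-- Primality of p is only used through p ≥ 2.
module Submission where

open import Defs
open import Data.Nat as ℕ using (ℕ; zero; suc; _∸_; _^_; s≤s; NonZero)
import Data.Nat.Properties as ℕP
open import Data.Nat.Primality using (Prime; ¬prime[0]; ¬prime[1])
open import Data.Integer using (ℤ; +_)
open import Data.Rational using (ℚ)
open import Data.Product using (_×_; _,_; proj₁; proj₂)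
open import Data.List using ([]; _∷_; _++_)
open import Data.List.Relation.Unary.All using (All; []; _∷_)
open import Data.Sum using (inj₁; inj₂)
open import Data.Bool using (true; false; T; if_then_else_)
open import Data.Unit using (tt)
open import Data.Empty using (⊥-elim)
open import Function using (_∘_)
open import Relation.Nullary using (yes; no; does)
open import Relation.Binary.Definitions using (tri<; tri≈; tri>)
open import Relation.Binary.PropositionalEquality

-- Finite sums f i + f (i + 1) + ⋯ of integers.
module FiniteSums where

  open import Data.Nat using (_≤_; _<_)
  open import Data.Integer using (0ℤ; _+_; _*_)
  import Data.Integer.Properties as ℤP
  open import Data.Integer.Tactic.RingSolver using (solve-∀)

  sumℤ : ℕ → ℕ → (ℕ → ℤ) → ℤ
  sumℤ zero i f = 0ℤ
  sumℤ (suc n) i f = f i + sumℤ n (suc i) f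

  sumℤ-cong : ∀ n i {f g} → (∀ j → i ≤ j → j < i ℕ.+ n → f j ≡ g j) → sumℤ n i f ≡ sumℤ n i g
  sumℤ-cong zero i f≗g = refl
  sumℤ-cong (suc n) i f≗g =
    cong₂ _+_ (f≗g i ℕP.≤-refl (ℕP.m<m+n i ℕ.z<s))
              (sumℤ-cong n (suc i) λ j i<j j<1+i+n →
                 f≗g j (ℕP.<⇒≤ i<j) (subst (j <_) (sym (ℕP.+-suc i n)) j<1+i+n))

  sumℤ-shift : ∀ n i f → sumℤ n (suc i) f ≡ sumℤ n i (f ∘ suc)
  sumℤ-shift zero i f = refl
  sumℤ-shift (suc n) i f = cong (_+_ (f (suc i))) (sumℤ-shift n (suc i) f)

  sumℤ-+ : ∀ n i f g → sumℤ n i (λ j → f j + g j) ≡ sumℤ n i f + sumℤ n i g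
  sumℤ-+ zero i f g = refl
  sumℤ-+ (suc n) i f g =
    trans (cong (_+_ (f i + g i)) (sumℤ-+ n (suc i) f g)) (interchange (f i) (g i) _ _)
    where
    interchange : ∀ a b c d → (a + b) + (c + d) ≡ (a + c) + (b + d)
    interchange = solve-∀

  sumℤ-scale : ∀ n i c f → sumℤ n i (λ j → c * f j) ≡ c * sumℤ n i f
  sumℤ-scale zero i c f = sym (ℤP.*-zeroʳ c)
  sumℤ-scale (suc n) i c f =
    trans (cong (_+_ (c * f i)) (sumℤ-scale n (suc i) c f)) (sym (ℤP.*-distribˡ-+ c (f i) _))

  sumℤ-split : ∀ a b i f → sumℤ (a ℕ.+ b) i f ≡ sumℤ a i f + sumℤ b (i ℕ.+ a) f
  sumℤ-split zero b i f = trans (sym (ℤP.+-identityˡ _)) (cong (λ j → 0ℤ + sumℤ b j f) (sym (ℕP.+-identityʳ i)))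
  sumℤ-split (suc a) b i f =
    trans (cong (_+_ (f i)) (trans (sumℤ-split a b (suc i) f)
                                (cong (λ j → sumℤ a (suc i) f + sumℤ b j f) (sym (ℕP.+-suc i a)))))
          (sym (ℤP.+-assoc (f i) _ _))

open FiniteSums

-- Pairing divisors with integer weights.
module Pairing where

  open import Data.Nat using (_≤_; _<_)
  open import Data.Integer using (0ℤ; 1ℤ; _+_; _*_)
  import Data.Integer.Properties as ℤP
  open import Data.Integer.Tactic.RingSolver using (solve-∀)
  open import Data.Rational.Properties using (_≟_)

  pairing : (ℚ → ℤ) → Divisor → ℤ
  pairing w [] = 0ℤ
  pairing w ((c , x) ∷ D) = c * w x + pairing w D

  pairing-++ : ∀ w A B → pairing w (A ++ B) ≡ pairing w A + pairing w B
  pairing-++ w [] B = sym (ℤP.+-identityˡ _)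
  pairing-++ w ((c , x) ∷ A) B =
    trans (cong (_+_ (c * w x)) (pairing-++ w A B)) (sym (ℤP.+-assoc (c * w x) _ _))

  pairing-scale : ∀ w a A → pairing w (scale a A) ≡ a * pairing w A
  pairing-scale w a [] = sym (ℤP.*-zeroʳ a)
  pairing-scale w a ((c , x) ∷ A) =
    trans (cong₂ _+_ (ℤP.*-assoc a c (w x)) (pairing-scale w a A))
          (sym (ℤP.*-distribˡ-+ a (c * w x) _))

  pairing-push : ∀ w f A → pairing w (push f A) ≡ pairing (w ∘ f) A
  pairing-push w f [] = refl
  pairing-push w f ((c , x) ∷ A) = cong (_+_ (c * w (f x))) (pairing-push w f A)

  pairing-scale-push : ∀ w c f A → pairing w (scale c (push f A)) ≡ c * pairing (w ∘ f) A
  pairing-scale-push w c f A = trans (pairing-scale w c (push f A)) (cong (c *_) (pairing-push w f A))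

  pairing-linExt : ∀ w R A → pairing w (linExt R A) ≡ pairing (λ x → pairing w (R x)) A
  pairing-linExt w R [] = refl
  pairing-linExt w R ((c , x) ∷ A) =
    trans (pairing-++ w (scale c (R x)) (linExt R A))
          (cong₂ _+_ (pairing-scale w c (R x)) (pairing-linExt w R A))

  pairing-linear : ∀ u v c A → pairing (λ x → u x + c * v x) A ≡ pairing u A + c * pairing v A
  pairing-linear u v c [] = sym (trans (ℤP.+-identityˡ _) (ℤP.*-zeroʳ c))
  pairing-linear u v c ((a , x) ∷ A) =
    trans (cong (_+_ (a * (u x + c * v x))) (pairing-linear u v c A))
          (regroup a (u x) c (v x) (pairing u A) (pairing v A))
    where
    regroup : ∀ a u c v U V → a * (u + c * v) + (U + c * V) ≡ (a * u + U) + c * (a * v + V)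
    regroup = solve-∀

  pairing-cong : ∀ (P : ℚ → Set) {u v} A → All (λ cx → P (proj₂ cx)) A →
                 (∀ x → P x → u x ≡ v x) → pairing u A ≡ pairing v A
  pairing-cong P [] [] u≗v = refl
  pairing-cong P ((c , x) ∷ A) (Px ∷ PA) u≗v =
    cong₂ (λ a b → c * a + b) (u≗v x Px) (pairing-cong P A PA u≗v)

  indicator : ℚ → ℚ → ℤ
  indicator y x = if does (x ≟ y) then 1ℤ else 0ℤ

  coeff-pairing : ∀ A y → coeff A y ≡ pairing (indicator y) A
  coeff-pairing [] y = refl
  coeff-pairing ((c , x) ∷ A) y with x ≟ y
  ... | yes _ = cong₂ _+_ (sym (ℤP.*-identityʳ c)) (coeff-pairing A y)
  ... | no _ = trans (coeff-pairing A y)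
                     (sym (trans (cong (_+ _) (ℤP.*-zeroʳ c)) (ℤP.+-identityˡ _)))

  ≈D-from-pairing : ∀ A B → (∀ w → pairing w A ≡ pairing w B) → A ≈D B
  ≈D-from-pairing A B same y =
    trans (coeff-pairing A y) (trans (same (indicator y)) (sym (coeff-pairing B y)))

  module _ (p : ℕ) (F : ℕ → Divisor) where

    ΣD-step : ∀ a b → a ≤ b → ΣD p a b F ≡ F a ++ ΣD p (suc a) b F
    ΣD-step a b a≤b rewrite ℕP.+-∸-assoc 1 a≤b = refl

    ΣD-empty : ∀ a b → b < a → ΣD p a b F ≡ []
    ΣD-empty a b b<a rewrite ℕP.m≤n⇒m∸n≡0 b<a = refl

    pairing-ΣD : ∀ w a b → pairing w (ΣD p a b F) ≡ sumℤ (suc b ∸ a) a (λ i → pairing w (F i))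
    pairing-ΣD w a b = go (suc b ∸ a) a refl
      where
      go : ∀ n a → suc b ∸ a ≡ n → pairing w (ΣD p a b F) ≡ sumℤ n a (λ i → pairing w (F i))
      go zero a len = cong (pairing w) (ΣD-empty a b (ℕP.m∸n≡0⇒m≤n len))
      go (suc n) a len with a ℕ.≤? b
      ... | yes a≤b =
        trans (cong (pairing w) (ΣD-step a b a≤b))
              (trans (pairing-++ w (F a) (ΣD p (suc a) b F))
                     (cong (_+_ (pairing w (F a)))
                           (go n (suc a) (ℕP.suc-injective (trans (sym (ℕP.+-∸-assoc 1 a≤b)) len)))))
      ... | no a≰b = ⊥-elim (ℕP.0≢1+n (trans (sym (ℕP.m≤n⇒m∸n≡0 (ℕP.≰⇒> a≰b))) len))

open Pairing

-- A label (n , j) names the affine bijection A^{((-1)^n)}_{k,j} : I_k → I_j.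
Label : Set
Label = ℕ × ℕ

-- The first branch of τ₁ maps I_{j+1} onto I_j by x ↦ px, keeping the
-- orientation, and maps I₀ onto itself by x ↦ 1 - x, reversing it.
expand : Label → Label
expand (n , zero) = (suc n , zero)
expand (n , suc j) = (n , j)

-- The second branch x ↦ x/p of τ₁ maps I_j onto I_{j+1}.
contract : Label → Label
contract (n , j) = (n , suc j)

module LabelSums (p k : ℕ) where

  open import Data.Nat using (_≤_; _<_; _<?_)
  open import Data.Integer using (1ℤ; _+_; _*_)
  import Data.Integer.Properties as ℤP
  open import Data.Integer.Tactic.RingSolver using (solve-∀)

  -- The label of the term of weight p^i in the formula for τ_m|_{I_k}:
  -- A^{((-1)^{m-k-i})}_{k,i} when i + k < m, and A^{(+1)}_{k,2i+k-m} otherwise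
  -- (the index 2i + k - m is written i + (i + k - m) to make it compute).
  label : ℕ → ℕ → Label
  label m i with i ℕ.+ k <? m
  ... | yes _ = (m ∸ (i ℕ.+ k) , i)
  ... | no _ = (0 , i ℕ.+ (i ℕ.+ k ∸ m))

  label-inner : ∀ m i → i ℕ.+ k < m → label m i ≡ (m ∸ (i ℕ.+ k) , i)
  label-inner m i lt with i ℕ.+ k <? m
  ... | yes _ = refl
  ... | no ¬lt = ⊥-elim (¬lt lt)

  label-outer : ∀ m i → m ≤ i ℕ.+ k → label m i ≡ (0 , i ℕ.+ (i ℕ.+ k ∸ m))
  label-outer m i le with i ℕ.+ k <? m
  ... | yes lt = ⊥-elim (ℕP.<⇒≱ lt le)
  ... | no _ = refl

  expand-label-suc : ∀ m j → expand (label (suc m) (suc j)) ≡ label m j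
  expand-label-suc m j with ℕP.<-≤-connex (j ℕ.+ k) m
  ... | inj₁ lt = trans (cong expand (label-inner (suc m) (suc j) (s≤s lt))) (sym (label-inner m j lt))
  ... | inj₂ le = trans (cong expand (label-outer (suc m) (suc j) (s≤s le))) (sym (label-outer m j le))

  contract-label : ∀ m j → contract (label m j) ≡ label (suc m) (suc j)
  contract-label m j with ℕP.<-≤-connex (j ℕ.+ k) m
  ... | inj₁ lt = trans (cong contract (label-inner m j lt)) (sym (label-inner (suc m) (suc j) (s≤s lt)))
  ... | inj₂ le = trans (cong contract (label-outer m j le)) (sym (label-outer (suc m) (suc j) (s≤s le)))

  expand-label-zero : ∀ m → expand (label m 0) ≡ label (suc m) 0
  expand-label-zero m with ℕP.<-cmp k m
  ... | tri< k<m _ _ =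
    trans (cong expand (label-inner m 0 k<m))
          (trans (cong (_, 0) (sym (ℕP.+-∸-assoc 1 (ℕP.<⇒≤ k<m))))
                 (sym (label-inner (suc m) 0 (ℕP.m<n⇒m<1+n k<m))))
  ... | tri≈ _ refl _ =
    trans (cong expand (label-outer k 0 ℕP.≤-refl))
          (trans (cong (λ d → expand (0 , d)) (ℕP.n∸n≡0 k))
                 (trans (cong (_, 0) (sym (ℕP.m+n∸n≡m 1 k)))
                        (sym (label-inner (suc k) 0 ℕP.≤-refl))))
  ... | tri> _ _ m<k =
    trans (cong expand (label-outer m 0 (ℕP.<⇒≤ m<k)))
          (trans (cong (λ d → expand (0 , d)) (ℕP.+-∸-assoc 1 m<k))
                 (sym (label-outer (suc m) 0 m<k)))

  labelSum : ℕ → (Label → ℤ) → ℤ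
  labelSum m W = sumℤ (suc m) 0 (λ i → + (p ^ i) * W (label m i))

  labelSum-cong : ∀ m {W W′} → (∀ l → W l ≡ W′ l) → labelSum m W ≡ labelSum m W′
  labelSum-cong m W≗W′ = sumℤ-cong (suc m) 0 (λ i _ _ → cong (+ (p ^ i) *_) (W≗W′ (label m i)))

  τ₁ᵀ : (Label → ℤ) → Label → ℤ
  τ₁ᵀ W l = W (expand l) + + p * W (contract l)

  labelSum-τ₁ᵀ : ∀ n W → labelSum n (τ₁ᵀ W) ≡
                 labelSum (suc n) W + sumℤ n 1 (λ i → + (p ^ i) * W (expand (label n i)))
  labelSum-τ₁ᵀ n W =
    begin
      labelSum n (τ₁ᵀ W)
    ≡⟨ sumℤ-cong (suc n) 0 (λ i _ _ → split-term i) ⟩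
      sumℤ (suc n) 0 (λ i → E i + C i)
    ≡⟨ sumℤ-+ (suc n) 0 E C ⟩
      (E 0 + tail) + sumℤ (suc n) 0 C
    ≡⟨ cong₂ (λ a c → (a + tail) + c) (cong (λ l → 1ℤ * W l) (expand-label-zero n)) contract-part ⟩
      (1ℤ * W (label (suc n) 0) + tail) + sumℤ (suc n) 1 L
    ≡⟨ swap (1ℤ * W (label (suc n) 0)) tail _ ⟩
      labelSum (suc n) W + tail
    ∎
    where
    open ≡-Reasoning
    E C L : ℕ → ℤ
    E i = + (p ^ i) * W (expand (label n i))
    C i = + (p ^ suc i) * W (contract (label n i))
    L i = + (p ^ i) * W (label (suc n) i)
    tail : ℤ
    tail = sumℤ n 1 E

    distribute : ∀ a b x y → a * (x + b * y) ≡ a * x + (b * a) * y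
    distribute = solve-∀

    split-term : ∀ i → + (p ^ i) * τ₁ᵀ W (label n i) ≡ E i + C i
    split-term i = trans (distribute (+ (p ^ i)) (+ p) _ _)
                         (cong (λ c → E i + c * W (contract (label n i))) (sym (ℤP.pos-* p (p ^ i))))

    contract-part : sumℤ (suc n) 0 C ≡ sumℤ (suc n) 1 L
    contract-part = trans (sumℤ-cong (suc n) 0 (λ i _ _ → cong (λ l → + (p ^ suc i) * W l) (contract-label n i)))
                          (sym (sumℤ-shift (suc n) 0 L))

    swap : ∀ a t c → (a + t) + c ≡ (a + c) + t
    swap = solve-∀

  -- For n = 0 the tail is empty, and for n = m + 1 it is p S_m.
  labelSum-base : ∀ W → labelSum 0 (τ₁ᵀ W) ≡ labelSum 1 W
  labelSum-base W = trans (labelSum-τ₁ᵀ 0 W) (ℤP.+-identityʳ _)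

  labelSum-step : ∀ m W → labelSum (suc m) (τ₁ᵀ W) ≡ labelSum (suc (suc m)) W + + p * labelSum m W
  labelSum-step m W =
    trans (labelSum-τ₁ᵀ (suc m) W)
          (cong (_+_ (labelSum (suc (suc m)) W)) tail-eq)
    where
    E : ℕ → ℤ
    E i = + (p ^ i) * W (expand (label (suc m) i))

    tail-eq : sumℤ (suc m) 1 E ≡ + p * labelSum m W
    tail-eq =
      trans (sumℤ-shift (suc m) 0 E)
            (trans (sumℤ-cong (suc m) 0 (λ j _ _ →
                      trans (cong₂ (λ c l → c * W l) (ℤP.pos-* p (p ^ j)) (expand-label-suc m j))
                            (ℤP.*-assoc (+ p) (+ (p ^ j)) _)))
                   (sumℤ-scale (suc m) 0 (+ p) (λ j → + (p ^ j) * W (label m j))))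


-- Arithmetic of ℚ used by the geometry: naturals, inverses, positivity.
module RationalFacts where

  open import Data.Rational using (0ℚ; 1ℚ; _+_; _*_; _-_; _≤_; _<_; toℚᵘ)
  import Data.Rational as ℚ
  import Data.Rational.Properties as ℚP
  import Data.Rational.Unnormalised as ℚᵘ
  import Data.Rational.Unnormalised.Properties as ℚᵘP
  import Data.Integer as ℤ
  import Data.Integer.Properties as ℤP
  open import Data.Maybe using (Maybe; just; nothing)
  import Tactic.RingSolver as RS
  open import Tactic.RingSolver.Core.AlmostCommutativeRing using (AlmostCommutativeRing; fromCommutativeRing)

  ℚ-ring : AlmostCommutativeRing _ _
  ℚ-ring = fromCommutativeRing ℚP.+-*-commutativeRing is-zero
    where
    is-zero : ∀ x → Maybe (0ℚ ≡ x)
    is-zero x with 0ℚ ℚP.≟ x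
    ... | yes e = just e
    ... | no _ = nothing

  -- The natural number n as a rational; in particular pℚ p = ι p.
  ι : ℕ → ℚ
  ι n = + n ℚ./ 1

  toℚᵘ-/ : ∀ i n → toℚᵘ (i ℚ./ suc n) ℚᵘ.≃ ℚᵘ.mkℚᵘ i n
  toℚᵘ-/ i n = ℚP.toℚᵘ-fromℚᵘ (ℚᵘ.mkℚᵘ i n)

  ι-+ : ∀ m n → ι (m ℕ.+ n) ≡ ι m + ι n
  ι-+ m n = ℚP.toℚᵘ-injective (ℚᵘP.≃-trans (toℚᵘ-/ (+ (m ℕ.+ n)) 0) (ℚᵘP.≃-trans sum≃
    (ℚᵘP.≃-sym (ℚᵘP.≃-trans (ℚP.toℚᵘ-homo-+ (ι m) (ι n)) (ℚᵘP.+-cong (toℚᵘ-/ (+ m) 0) (toℚᵘ-/ (+ n) 0))))))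
    where
    sum≃ : ℚᵘ.mkℚᵘ (+ (m ℕ.+ n)) 0 ℚᵘ.≃ ℚᵘ.mkℚᵘ (+ m) 0 ℚᵘ.+ ℚᵘ.mkℚᵘ (+ n) 0
    sum≃ = ℚᵘ.*≡* (cong (ℤ._* + 1) (trans (ℤP.pos-+ m n)
                    (sym (cong₂ ℤ._+_ (ℤP.*-identityʳ (+ m)) (ℤP.*-identityʳ (+ n))))))

  ι-* : ∀ m n → ι (m ℕ.* n) ≡ ι m * ι n
  ι-* m n = ℚP.toℚᵘ-injective (ℚᵘP.≃-trans (toℚᵘ-/ (+ (m ℕ.* n)) 0) (ℚᵘP.≃-trans product≃
    (ℚᵘP.≃-sym (ℚᵘP.≃-trans (ℚP.toℚᵘ-homo-* (ι m) (ι n)) (ℚᵘP.*-cong (toℚᵘ-/ (+ m) 0) (toℚᵘ-/ (+ n) 0))))))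
    where
    product≃ : ℚᵘ.mkℚᵘ (+ (m ℕ.* n)) 0 ℚᵘ.≃ ℚᵘ.mkℚᵘ (+ m) 0 ℚᵘ.* ℚᵘ.mkℚᵘ (+ n) 0
    product≃ = ℚᵘ.*≡* (cong (ℤ._* + 1) (ℤP.pos-* m n))

  ι*invℕ : ∀ n .{{_ : NonZero n}} → ι n * invℕ n ≡ 1ℚ
  ι*invℕ (suc n) = ℚP.toℚᵘ-injective (ℚᵘP.≃-trans (ℚP.toℚᵘ-homo-* (ι (suc n)) (invℕ (suc n)))
    (ℚᵘP.≃-trans (ℚᵘP.*-cong (toℚᵘ-/ (+ suc n) 0) (toℚᵘ-/ (+ 1) n)) product≃))
    where
    product≃ : ℚᵘ.mkℚᵘ (+ suc n) 0 ℚᵘ.* ℚᵘ.mkℚᵘ (+ 1) n ℚᵘ.≃ ℚᵘ.mkℚᵘ (+ 1) 0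
    product≃ = ℚᵘ.*≡* (trans (ℤP.*-identityʳ _) (trans (ℤP.*-identityʳ (+ suc n))
                 (sym (trans (ℤP.*-identityˡ _) (cong +_ (ℕP.*-identityˡ (suc n)))))))

  invℕ-unique : ∀ n .{{_ : NonZero n}} {r} → ι n * r ≡ 1ℚ → invℕ n ≡ r
  invℕ-unique n {r} ιn*r≡1 =
    begin
      invℕ n              ≡⟨ sym (ℚP.*-identityʳ (invℕ n)) ⟩
      invℕ n * 1ℚ         ≡⟨ cong (invℕ n *_) (sym ιn*r≡1) ⟩
      invℕ n * (ι n * r)  ≡⟨ reassoc (invℕ n) (ι n) r ⟩
      (ι n * invℕ n) * r  ≡⟨ cong (_* r) (ι*invℕ n) ⟩
      1ℚ * r              ≡⟨ ℚP.*-identityˡ r ⟩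
      r                   ∎
    where
    open ≡-Reasoning
    reassoc : ∀ a b c → a * (b * c) ≡ (b * a) * c
    reassoc = RS.solve-∀ ℚ-ring

  invℕ-* : ∀ m n .{{_ : NonZero m}} .{{_ : NonZero n}} → invℕ (m ℕ.* n) ≡ invℕ m * invℕ n
  invℕ-* m@(suc _) n@(suc _) = invℕ-unique (m ℕ.* n)
    (trans (cong (_* (invℕ m * invℕ n)) (ι-* m n))
    (trans (interchange (ι m) (ι n) (invℕ m) (invℕ n))
    (trans (cong₂ _*_ (ι*invℕ m) (ι*invℕ n)) (ℚP.*-identityˡ 1ℚ))))
    where
    interchange : ∀ a b c d → (a * b) * (c * d) ≡ (a * c) * (b * d)
    interchange = RS.solve-∀ ℚ-ring

  invℕ-pos : ∀ n .{{_ : NonZero n}} → 0ℚ < invℕ n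
  invℕ-pos (suc n) = ℚP.positive⁻¹ (invℕ (suc n)) {{ℚP.normalize-pos 1 (suc n)}}

  ι-pos : ∀ n .{{_ : NonZero n}} → 0ℚ < ι n
  ι-pos (suc n) = ℚP.positive⁻¹ (ι (suc n)) {{ℚP.normalize-pos (suc n) 1}}

  pos-* : ∀ {a b} → 0ℚ < a → 0ℚ < b → 0ℚ < a * b
  pos-* {a} {b} 0<a 0<b = ℚP.positive⁻¹ (a * b) {{ℚP.pos*pos⇒pos a {{ℚ.positive 0<a}} b {{ℚ.positive 0<b}}}}

  nonneg-* : ∀ {a b} → 0ℚ ≤ a → 0ℚ ≤ b → 0ℚ ≤ a * b
  nonneg-* {a} {b} 0≤a 0≤b =
    ℚP.nonNegative⁻¹ (a * b) {{ℚP.nonNeg*nonNeg⇒nonNeg a {{ℚ.nonNegative 0≤a}} b {{ℚ.nonNegative 0≤b}}}}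

  ≤-from-diff : ∀ {a b} → 0ℚ ≤ b - a → a ≤ b
  ≤-from-diff {a} {b} 0≤b-a = subst₂ _≤_ (ℚP.+-identityʳ a) (cancel a b) (ℚP.+-monoʳ-≤ a 0≤b-a)
    where
    cancel : ∀ a b → a + (b - a) ≡ b
    cancel = RS.solve-∀ ℚ-ring

  diff-from-≤ : ∀ {a b} → a ≤ b → 0ℚ ≤ b - a
  diff-from-≤ {a} {b} a≤b = subst (_≤ b - a) (ℚP.+-inverseʳ a) (ℚP.+-monoˡ-≤ (ℚ.- a) a≤b)

  recip-inverse : ∀ r → 0ℚ < r → r * recip r ≡ 1ℚ
  recip-inverse r 0<r with r ℚP.≟ 0ℚ
  ... | yes r≡0 = ⊥-elim (ℚP.<-irrefl (sym r≡0) 0<r)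
  ... | no r≢0 = ℚP.*-inverseʳ r {{ℚ.≢-nonZero r≢0}}

  recip-pos : ∀ r → 0ℚ < r → 0ℚ < recip r
  recip-pos r 0<r with r ℚP.≟ 0ℚ
  ... | yes r≡0 = ⊥-elim (ℚP.<-irrefl (sym r≡0) 0<r)
  ... | no r≢0 = ℚP.positive⁻¹ _ {{ℚP.1/pos⇒pos r {{ℚ.positive 0<r}}}}

-- The geometry of the intervals I_j for p = q + 2 ≥ 2.
module Geometry (q : ℕ) where

  open import Data.Rational using (0ℚ; 1ℚ; _+_; _*_; _-_; _≤_; _<_; _≤ᵇ_)
  import Data.Rational.Properties as ℚP
  import Tactic.RingSolver as RS
  open RationalFacts

  p : ℕ
  p = suc (suc q)

  ξ : ℕ → ℚ
  ξ = xk p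

  gap : ℕ → ℚ
  gap j = ξ j - ξ (suc j)

  ξ-step : ∀ j → ι p * ξ (suc j) ≡ ξ j
  ξ-step j =
    begin
      ι p * (c * invℕ (p ℕ.* p ℕ.^ j))
    ≡⟨ cong (λ r → ι p * (c * r)) (invℕ-* p (p ℕ.^ j) {{_}} {{ℕP.m^n≢0 p j}}) ⟩
      ι p * (c * (invℕ p * invℕ (p ℕ.^ j)))
    ≡⟨ reassoc (ι p) c (invℕ p) (invℕ (p ℕ.^ j)) ⟩
      (c * invℕ (p ℕ.^ j)) * (ι p * invℕ p)
    ≡⟨ cong ((c * invℕ (p ℕ.^ j)) *_) (ι*invℕ p) ⟩
      (c * invℕ (p ℕ.^ j)) * 1ℚ
    ≡⟨ ℚP.*-identityʳ _ ⟩
      ξ j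
    ∎
    where
    open ≡-Reasoning
    c : ℚ
    c = ι p * invℕ (suc p)
    reassoc : ∀ a c u w → a * (c * (u * w)) ≡ (c * w) * (a * u)
    reassoc = RS.solve-∀ ℚ-ring

  -- x₁ = 1/(p+1) is the point where τ₁ switches between its two formulas.
  ξ-one : ξ 1 ≡ invℕ (suc p)
  ξ-one =
    begin
      (ι p * v) * invℕ (p ℕ.* 1)
    ≡⟨ cong (λ n → (ι p * v) * invℕ n) (ℕP.*-identityʳ p) ⟩
      (ι p * v) * invℕ p
    ≡⟨ reassoc (ι p) v (invℕ p) ⟩
      v * (ι p * invℕ p)
    ≡⟨ cong (v *_) (ι*invℕ p) ⟩
      v * 1ℚ
    ≡⟨ ℚP.*-identityʳ v ⟩
      v
    ∎
    where
    open ≡-Reasoning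
    v : ℚ
    v = invℕ (suc p)
    reassoc : ∀ a v u → (a * v) * u ≡ v * (a * u)
    reassoc = RS.solve-∀ ℚ-ring

  -- x₀ + x₁ = 1, so the reflection x ↦ 1 - x maps I₀ = [x₁, x₀] onto itself.
  ξ-sum : ξ 0 + ξ 1 ≡ 1ℚ
  ξ-sum =
    begin
      ξ 0 + ξ 1
    ≡⟨ cong (_+ ξ 1) (sym (ξ-step 0)) ⟩
      ι p * ξ 1 + ξ 1
    ≡⟨ cong (λ v → ι p * v + v) ξ-one ⟩
      ι p * v + v
    ≡⟨ factor (ι p) v ⟩
      (1ℚ + ι p) * v
    ≡⟨ cong (_* v) (sym (ι-+ 1 p)) ⟩
      ι (suc p) * v
    ≡⟨ ι*invℕ (suc p) ⟩
      1ℚ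
    ∎
    where
    open ≡-Reasoning
    v : ℚ
    v = invℕ (suc p)
    factor : ∀ a v → a * v + v ≡ (1ℚ + a) * v
    factor = RS.solve-∀ ℚ-ring

  gap-eq : ∀ j → gap j ≡ ι (suc q) * ξ (suc j)
  gap-eq j =
    begin
      ξ j - ξ (suc j)
    ≡⟨ cong (_- ξ (suc j)) (sym (ξ-step j)) ⟩
      ι p * ξ (suc j) - ξ (suc j)
    ≡⟨ cong (λ a → a * ξ (suc j) - ξ (suc j)) (ι-+ 1 (suc q)) ⟩
      (1ℚ + ι (suc q)) * ξ (suc j) - ξ (suc j)
    ≡⟨ cancel (ι (suc q)) (ξ (suc j)) ⟩
      ι (suc q) * ξ (suc j)
    ∎
    where
    open ≡-Reasoning
    cancel : ∀ b z → (1ℚ + b) * z - z ≡ b * z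
    cancel = RS.solve-∀ ℚ-ring

  ξ-pos : ∀ j → 0ℚ < ξ j
  ξ-pos j = pos-* (pos-* (ι-pos p) (invℕ-pos (suc p))) (invℕ-pos (p ℕ.^ j) {{ℕP.m^n≢0 p j}})

  gap-pos : ∀ j → 0ℚ < gap j
  gap-pos j = subst (0ℚ <_) (sym (gap-eq j)) (pos-* (ι-pos (suc q)) (ξ-pos (suc j)))

  ξ-antitone : ∀ j → ξ (suc j) ≤ ξ 1
  ξ-antitone zero = ℚP.≤-refl
  ξ-antitone (suc j) = ℚP.≤-trans (≤-from-diff (ℚP.<⇒≤ (gap-pos (suc j)))) (ξ-antitone j)

  two-points : ℚ → ℚ → Divisor
  two-points a b = (+ 1 , a) ∷ (+ p , b) ∷ []

  -- On I₀ the first branch of τ₁ is the reflection x ↦ 1 - x (both formulas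
  -- agree at the boundary point 1/(p+1)).
  τ₁pt-I₀ : ∀ {z} → InI p 0 z → τ₁pt p z ≡ two-points (1ℚ - z) (z * invℕ p)
  τ₁pt-I₀ {z} (ξ₁≤z , _) with z ≤ᵇ invℕ (suc p) in below
  ... | false = refl
  ... | true = cong (λ w → two-points w (z * invℕ p)) boundary
    where
    z≡ξ₁ : z ≡ ξ 1
    z≡ξ₁ = ℚP.≤-antisym (subst (z ≤_) (sym ξ-one) (ℚP.≤ᵇ⇒≤ (subst T (sym below) _))) ξ₁≤z
    rearrange : ∀ a b → a ≡ (a + b) - b
    rearrange = RS.solve-∀ ℚ-ring
    boundary : ι p * z ≡ 1ℚ - z
    boundary = trans (cong (ι p *_) z≡ξ₁) (trans (ξ-step 0)
               (trans (rearrange (ξ 0) (ξ 1)) (cong₂ _-_ ξ-sum (sym z≡ξ₁))))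

  τ₁pt-I₊ : ∀ {j z} → InI p (suc j) z → τ₁pt p z ≡ two-points (ι p * z) (z * invℕ p)
  τ₁pt-I₊ {j} {z} (_ , z≤ξ) with z ≤ᵇ invℕ (suc p) in below
  ... | true = refl
  ... | false = ⊥-elim (subst T below (ℚP.≤⇒≤ᵇ (subst (z ≤_) ξ-one (ℚP.≤-trans z≤ξ (ξ-antitone j)))))

  -- point j s is the point of I_j at relative position s from its left end.
  point : ℕ → ℚ → ℚ
  point j s = ξ (suc j) + gap j * s

  UnitInterval : ℚ → Set
  UnitInterval s = (0ℚ ≤ s) × (s ≤ 1ℚ)

  point-∈ : ∀ j {s} → UnitInterval s → InI p j (point j s)
  point-∈ j {s} (0≤s , s≤1) =
      ≤-from-diff (subst (0ℚ ≤_) (sym (shift (ξ (suc j)) (gap j * s))) (nonneg-* gap≥0 0≤s))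
    , ≤-from-diff (subst (0ℚ ≤_) (rest (ξ j) (ξ (suc j)) s) (nonneg-* gap≥0 (diff-from-≤ s≤1)))
    where
    gap≥0 : 0ℚ ≤ gap j
    gap≥0 = ℚP.<⇒≤ (gap-pos j)
    shift : ∀ a b → (a + b) - a ≡ b
    shift = RS.solve-∀ ℚ-ring
    rest : ∀ a b s → (a - b) * (1ℚ - s) ≡ a - (b + (a - b) * s)
    rest = RS.solve-∀ ℚ-ring

  flip-∈ : ∀ {s} → UnitInterval s → UnitInterval (1ℚ - s)
  flip-∈ {s} (0≤s , s≤1) =
    diff-from-≤ s≤1 , ≤-from-diff (subst (0ℚ ≤_) (sym (flip 1ℚ s)) 0≤s)
    where
    flip : ∀ a s → a - (a - s) ≡ s
    flip = RS.solve-∀ ℚ-ring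

  point-scale : ∀ j s → ι p * point (suc j) s ≡ point j s
  point-scale j s =
    begin
      ι p * (ξ (suc (suc j)) + (ξ (suc j) - ξ (suc (suc j))) * s)
    ≡⟨ distribute (ι p) (ξ (suc j)) (ξ (suc (suc j))) s ⟩
      ι p * ξ (suc (suc j)) + (ι p * ξ (suc j) - ι p * ξ (suc (suc j))) * s
    ≡⟨ cong₂ (λ a b → a + (b - a) * s) (ξ-step (suc j)) (ξ-step j) ⟩
      point j s
    ∎
    where
    open ≡-Reasoning
    distribute : ∀ a b c s → a * (c + (b - c) * s) ≡ a * c + (a * b - a * c) * s
    distribute = RS.solve-∀ ℚ-ring

  point-divide : ∀ j s → point j s * invℕ p ≡ point (suc j) s
  point-divide j s =
    begin
      point j s * invℕ p
    ≡⟨ cong (_* invℕ p) (sym (point-scale j s)) ⟩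
      (ι p * point (suc j) s) * invℕ p
    ≡⟨ reassoc (ι p) (point (suc j) s) (invℕ p) ⟩
      point (suc j) s * (ι p * invℕ p)
    ≡⟨ cong (point (suc j) s *_) (ι*invℕ p) ⟩
      point (suc j) s * 1ℚ
    ≡⟨ ℚP.*-identityʳ _ ⟩
      point (suc j) s
    ∎
    where
    open ≡-Reasoning
    reassoc : ∀ a z u → (a * z) * u ≡ z * (a * u)
    reassoc = RS.solve-∀ ℚ-ring

  point-reflect : ∀ s → 1ℚ - point 0 s ≡ point 0 (1ℚ - s)
  point-reflect s =
    begin
      1ℚ - (ξ 1 + (ξ 0 - ξ 1) * s)
    ≡⟨ cong (λ a → a - (ξ 1 + (ξ 0 - ξ 1) * s)) (sym ξ-sum) ⟩
      (ξ 0 + ξ 1) - (ξ 1 + (ξ 0 - ξ 1) * s)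
    ≡⟨ reflect (ξ 0) (ξ 1) s ⟩
      point 0 (1ℚ - s)
    ∎
    where
    open ≡-Reasoning
    reflect : ∀ a b s → (a + b) - (b + (a - b) * s) ≡ b + (a - b) * (1ℚ - s)
    reflect = RS.solve-∀ ℚ-ring

  Ψ : ℕ → Label → ℚ → ℚ
  Ψ k (n , j) = Asign p n k j

  module Affine (k : ℕ) {z : ℚ} (z∈I : InI p k z) where

    t : ℚ
    t = (z - ξ (suc k)) * recip (gap k)

    private
      r : ℚ
      r = recip (gap k)

      gap*r : gap k * r ≡ 1ℚ
      gap*r = recip-inverse (gap k) (gap-pos k)

    t-∈ : UnitInterval t
    t-∈ = nonneg-* (diff-from-≤ (proj₁ z∈I)) r≥0
        , ≤-from-diff (subst (0ℚ ≤_) complement (nonneg-* (diff-from-≤ (proj₂ z∈I)) r≥0))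
      where
      r≥0 : 0ℚ ≤ r
      r≥0 = ℚP.<⇒≤ (recip-pos (gap k) (gap-pos k))
      split : ∀ a b x r → (a - x) * r ≡ (a - b) * r - (x - b) * r
      split = RS.solve-∀ ℚ-ring
      complement : (ξ k - z) * r ≡ 1ℚ - t
      complement = trans (split (ξ k) (ξ (suc k)) z r) (cong (_- t) gap*r)

    Aplus-point : ∀ j → Aplus p k j z ≡ point j t
    Aplus-point j = reassoc (ξ (suc j)) (z - ξ (suc k)) (gap j) r
      where
      reassoc : ∀ y x g r → y + (x * g) * r ≡ y + g * (x * r)
      reassoc = RS.solve-∀ ℚ-ring

    Aminus-point : ∀ j → Aminus p k j z ≡ point j (1ℚ - t)
    Aminus-point j = reflect (ξ j) (ξ (suc j)) (z - ξ (suc k)) r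
      where
      reflect : ∀ a b x r → a - (x * (a - b)) * r ≡ b + (a - b) * (1ℚ - x * r)
      reflect = RS.solve-∀ ℚ-ring

    Aplus-self : Aplus p k k z ≡ z
    Aplus-self =
      begin
        Aplus p k k z
      ≡⟨ reassoc (ξ (suc k)) (z - ξ (suc k)) (gap k) r ⟩
        ξ (suc k) + (z - ξ (suc k)) * (gap k * r)
      ≡⟨ cong (λ a → ξ (suc k) + (z - ξ (suc k)) * a) gap*r ⟩
        ξ (suc k) + (z - ξ (suc k)) * 1ℚ
      ≡⟨ cancel (ξ (suc k)) z ⟩
        z
      ∎
      where
      open ≡-Reasoning
      reassoc : ∀ y x g r → y + (x * g) * r ≡ y + x * (g * r)
      reassoc = RS.solve-∀ ℚ-ring
      cancel : ∀ y z → y + (z - y) * 1ℚ ≡ z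
      cancel = RS.solve-∀ ℚ-ring

    position : ℕ → ℚ
    position n with n ℕ.% 2
    ... | zero = t
    ... | suc _ = 1ℚ - t

    Ψ-point : ∀ n j → Ψ k (n , j) z ≡ point j (position n)
    Ψ-point n j with n ℕ.% 2
    ... | zero = Aplus-point j
    ... | suc _ = Aminus-point j

    position-∈ : ∀ n → UnitInterval (position n)
    position-∈ n with n ℕ.% 2
    ... | zero = t-∈
    ... | suc _ = flip-∈ t-∈

    position-suc : ∀ n → position (suc n) ≡ 1ℚ - position n
    position-suc zero = refl
    position-suc (suc zero) = sym (flip 1ℚ t)
      where
      flip : ∀ a s → a - (a - s) ≡ s
      flip = RS.solve-∀ ℚ-ring
    position-suc (suc (suc n)) = position-suc n

    τ₁pt-Ψ : ∀ l → τ₁pt p (Ψ k l z) ≡ two-points (Ψ k (expand l) z) (Ψ k (contract l) z)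
    τ₁pt-Ψ (n , zero) =
      begin
        τ₁pt p (Ψ k (n , 0) z)
      ≡⟨ cong (τ₁pt p) (Ψ-point n 0) ⟩
        τ₁pt p (point 0 s)
      ≡⟨ τ₁pt-I₀ (point-∈ 0 (position-∈ n)) ⟩
        two-points (1ℚ - point 0 s) (point 0 s * invℕ p)
      ≡⟨ cong₂ two-points reflected (trans (point-divide 0 s) (sym (Ψ-point n 1))) ⟩
        two-points (Ψ k (suc n , 0) z) (Ψ k (n , 1) z)
      ∎
      where
      open ≡-Reasoning
      s : ℚ
      s = position n

      reflected : 1ℚ - point 0 s ≡ Ψ k (suc n , 0) z
      reflected = trans (point-reflect s)
                        (trans (cong (point 0) (sym (position-suc n))) (sym (Ψ-point (suc n) 0)))
    τ₁pt-Ψ (n , suc j) =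
      begin
        τ₁pt p (Ψ k (n , suc j) z)
      ≡⟨ cong (τ₁pt p) (Ψ-point n (suc j)) ⟩
        τ₁pt p (point (suc j) s)
      ≡⟨ τ₁pt-I₊ {j} (point-∈ (suc j) (position-∈ n)) ⟩
        two-points (ι p * point (suc j) s) (point (suc j) s * invℕ p)
      ≡⟨ cong₂ two-points (trans (point-scale j s) (sym (Ψ-point n j)))
                          (trans (point-divide (suc j) s) (sym (Ψ-point n (suc (suc j))))) ⟩
        two-points (Ψ k (n , j) z) (Ψ k (n , suc (suc j)) z)
      ∎
      where
      open ≡-Reasoning
      s : ℚ
      s = position n

module Main (q k : ℕ) (D : Divisor) (D⊆I : All (λ cx → InI (suc (suc q)) k (proj₂ cx)) D) where

  open import Data.Nat using (_≤_; _<_)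
  open import Data.Integer using (0ℤ; 1ℤ; _+_; _*_; -_)
  import Data.Integer.Properties as ℤP
  open import Data.Integer.Tactic.RingSolver using (solve-∀)
  open import Data.Nat.Tactic.RingSolver as ℕSolver using ()
  open Geometry q
  open LabelSums p k

  W : (ℚ → ℤ) → Label → ℤ
  W w l = pairing (w ∘ Ψ k l) D

  τ₁ᵀ-pt : (ℚ → ℤ) → ℚ → ℤ
  τ₁ᵀ-pt w z = pairing w (τ₁pt p z)

  W-τ₁ : ∀ w l → W (τ₁ᵀ-pt w) l ≡ τ₁ᵀ (W w) l
  W-τ₁ w l =
    trans (pairing-cong (InI p k) D D⊆I (λ z z∈I →
             trans (cong (pairing w) (Affine.τ₁pt-Ψ k z∈I l)) (pairing-two-points _ _)))
          (pairing-linear (w ∘ Ψ k (expand l)) (w ∘ Ψ k (contract l)) (+ p) D)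
    where
    pairing-two-points : ∀ a b → pairing w (two-points a b) ≡ w a + + p * w b
    pairing-two-points a b = simplify (w a) (+ p * w b)
      where
      simplify : ∀ x y → 1ℤ * x + (y + 0ℤ) ≡ x + y
      simplify = solve-∀

  τ₁-pairing : ∀ n X → (∀ w → pairing w X ≡ labelSum n (W w)) →
               ∀ w → pairing w (τ₁ p X) ≡ labelSum n (τ₁ᵀ (W w))
  τ₁-pairing n X hyp w =
    trans (pairing-linExt w (τ₁pt p) X)
          (trans (hyp (τ₁ᵀ-pt w)) (labelSum-cong n (W-τ₁ w)))

  τ-pairing : ∀ m w → pairing w (τ p m D) ≡ labelSum m (W w)
  τ-pairing zero w =
    sym (trans (ℤP.+-identityʳ _) (trans (ℤP.*-identityˡ _)
          (pairing-cong (InI p k) D D⊆I (λ z z∈I → cong w (Affine.Aplus-self k z∈I)))))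
  τ-pairing (suc zero) w =
    trans (τ₁-pairing 0 D (τ-pairing 0) w) (labelSum-base (W w))
  τ-pairing (suc (suc m)) w =
    begin
      pairing w (τ₁ p (τ p (suc m) D) ++ scale (- + p) (τ p m D))
    ≡⟨ pairing-++ w (τ₁ p (τ p (suc m) D)) (scale (- + p) (τ p m D)) ⟩
      pairing w (τ₁ p (τ p (suc m) D)) + pairing w (scale (- + p) (τ p m D))
    ≡⟨ cong₂ _+_ (τ₁-pairing (suc m) (τ p (suc m) D) (τ-pairing (suc m)) w)
                 (trans (pairing-scale w (- + p) (τ p m D)) (cong (- + p *_) (τ-pairing m w))) ⟩
      labelSum (suc m) (τ₁ᵀ (W w)) + (- + p) * labelSum m (W w)
    ≡⟨ cong (_+ (- + p) * labelSum m (W w)) (labelSum-step m (W w)) ⟩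
      (labelSum (suc (suc m)) (W w) + + p * labelSum m (W w)) + (- + p) * labelSum m (W w)
    ≡⟨ cancel (labelSum (suc (suc m)) (W w)) (+ p) (labelSum m (W w)) ⟩
      labelSum (suc (suc m)) (W w)
    ∎
    where
    open ≡-Reasoning
    cancel : ∀ a c l → (a + c * l) + (- c) * l ≡ a
    cancel = solve-∀

  inner-term outer-term : ℕ → ℕ → Divisor
  inner-term m i = scale (+ (p ^ i)) (push (Asign p (m ∸ k ∸ i) k i) D)
  outer-term m i = scale (+ (p ^ i)) (push (Aplus p k (2 ℕ.* i ℕ.+ k ∸ m)) D)

  term-inner : ∀ m w i → i ℕ.+ k < m → pairing w (inner-term m i) ≡ + (p ^ i) * W w (label m i)
  term-inner m w i lt =
    trans (pairing-scale-push w (+ (p ^ i)) _ D)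
          (cong (λ l → + (p ^ i) * W w l) (sym (trans (label-inner m i lt) (cong (_, i) exponent))))
    where
    exponent : m ∸ (i ℕ.+ k) ≡ m ∸ k ∸ i
    exponent = trans (cong (m ∸_) (ℕP.+-comm i k)) (sym (ℕP.∸-+-assoc m k i))

  term-outer : ∀ m w i → m ≤ i ℕ.+ k → pairing w (outer-term m i) ≡ + (p ^ i) * W w (label m i)
  term-outer m w i le =
    trans (pairing-scale-push w (+ (p ^ i)) _ D)
          (cong (λ l → + (p ^ i) * W w l) (sym (trans (label-outer m i le) (cong (0 ,_) index))))
    where
    double : ∀ i k → 2 ℕ.* i ℕ.+ k ≡ i ℕ.+ (i ℕ.+ k)
    double = ℕSolver.solve-∀
    index : i ℕ.+ (i ℕ.+ k ∸ m) ≡ 2 ℕ.* i ℕ.+ k ∸ m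
    index = sym (trans (cong (_∸ m) (double i k)) (ℕP.+-∸-assoc i le))

  rhs-pairing-≤ : ∀ m w → m ≤ k → pairing w (ΣD p 0 m (outer-term m)) ≡ labelSum m (W w)
  rhs-pairing-≤ m w m≤k =
    trans (pairing-ΣD p (outer-term m) w 0 m)
          (sumℤ-cong (suc m) 0 (λ i _ _ → term-outer m w i (ℕP.≤-trans m≤k (ℕP.m≤n+m k i))))

  -- For k < m the range [0, m] splits at d = m - k into the two regimes.
  module Split {m} (k<m : k < m) where

    d : ℕ
    d = m ∸ k

    d+k≡m : d ℕ.+ k ≡ m
    d+k≡m = ℕP.m∸n+n≡m (ℕP.<⇒≤ k<m)

    first-length : suc (d ∸ 1) ≡ d
    first-length = trans (cong (λ n → suc (n ∸ 1)) d≡) (sym d≡)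
      where
      d≡ : d ≡ suc (m ∸ suc k)
      d≡ = ℕP.+-∸-assoc 1 k<m

    second-length : suc m ∸ d ≡ suc k
    second-length = trans (ℕP.+-∸-assoc 1 (ℕP.m∸n≤m m k)) (cong suc (ℕP.m∸[m∸n]≡n (ℕP.<⇒≤ k<m)))

    total-length : d ℕ.+ suc k ≡ suc m
    total-length = trans (ℕP.+-suc d k) (cong suc d+k≡m)

    inner : ∀ i → i < d → i ℕ.+ k < m
    inner i i<d = subst (i ℕ.+ k <_) d+k≡m (ℕP.+-monoˡ-< k i<d)

    outer : ∀ i → d ≤ i → m ≤ i ℕ.+ k
    outer i d≤i = subst (_≤ i ℕ.+ k) d+k≡m (ℕP.+-monoˡ-≤ k d≤i)

  rhs-pairing-> : ∀ m w → k < m →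
    pairing w (ΣD p 0 (m ∸ k ∸ 1) (inner-term m) ++ ΣD p (m ∸ k) m (outer-term m)) ≡ labelSum m (W w)
  rhs-pairing-> m w k<m =
    begin
      pairing w (ΣD p 0 (d ∸ 1) (inner-term m) ++ ΣD p d m (outer-term m))
    ≡⟨ pairing-++ w (ΣD p 0 (d ∸ 1) (inner-term m)) (ΣD p d m (outer-term m)) ⟩
      pairing w (ΣD p 0 (d ∸ 1) (inner-term m)) + pairing w (ΣD p d m (outer-term m))
    ≡⟨ cong₂ _+_ (pairing-ΣD p (inner-term m) w 0 (d ∸ 1)) (pairing-ΣD p (outer-term m) w d m) ⟩
      sumℤ (suc (d ∸ 1)) 0 (pairing w ∘ inner-term m) + sumℤ (suc m ∸ d) d (pairing w ∘ outer-term m)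
    ≡⟨ cong₂ (λ a b → sumℤ a 0 (pairing w ∘ inner-term m) + sumℤ b d (pairing w ∘ outer-term m))
             first-length second-length ⟩
      sumℤ d 0 (pairing w ∘ inner-term m) + sumℤ (suc k) d (pairing w ∘ outer-term m)
    ≡⟨ cong₂ _+_ (sumℤ-cong d 0 (λ i _ i<d → term-inner m w i (inner i i<d)))
                 (sumℤ-cong (suc k) d (λ i d≤i _ → term-outer m w i (outer i d≤i))) ⟩
      sumℤ d 0 F + sumℤ (suc k) d F
    ≡⟨ sym (sumℤ-split d (suc k) 0 F) ⟩
      sumℤ (d ℕ.+ suc k) 0 F
    ≡⟨ cong (λ n → sumℤ n 0 F) total-length ⟩
      labelSum m (W w)
    ∎
    where
    open ≡-Reasoning
    open Split k<m
    F : ℕ → ℤ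
    F i = + (p ^ i) * W w (label m i)

  rhs-pairing : ∀ m w → pairing w (rhs p k m D) ≡ labelSum m (W w)
  rhs-pairing m w with m ℕ.≤ᵇ k in m≤ᵇk
  ... | true = rhs-pairing-≤ m w (ℕP.≤ᵇ⇒≤ m k (subst T (sym m≤ᵇk) tt))
  ... | false = rhs-pairing-> m w (ℕP.≰⇒> (λ m≤k → subst T m≤ᵇk (ℕP.≤⇒≤ᵇ m≤k)))

lemma5p7 : (p : ℕ) → Prime p → (k m : ℕ) → (D : Divisor) →
    All (λ cx → InI p k (proj₂ cx)) D →
    τ p m D ≈D rhs p k m D
lemma5p7 zero p-prime = ⊥-elim (¬prime[0] p-prime)
lemma5p7 (suc zero) p-prime = ⊥-elim (¬prime[1] p-prime)
lemma5p7 p@(suc (suc q)) _ k m D D⊆I =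
  ≈D-from-pairing (τ p m D) (rhs p k m D) (λ w → trans (τ-pairing m w) (sym (rhs-pairing m w)))
  where open Main q k D D⊆I
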